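{- Let $C$ be a partially shaded tree (corresponding to a vertex of the non-degenerate transportation polytope $TP(u,v)$), and assume some supply node satisfies (SIN) in $C$. Then no demand node is incident in $C$ only to shaded $+$edges. In particular, every well-connected demand node of $C$ is incident to a shaded $-$edge.
   Context: Let $u\in\mathbb{R}^{N_1}_{>0}$, $v\in\mathbb{R}^{N_2}_{>0}$ with $\sum_iu_i=\sum_jv_j$, and $TP(u,v)=\{y\in\mathbb{R}^{N_1\times N_2}_{\ge0}:\sum_j y_{ij}=u_i\ \forall i,\ \sum_i y_{ij}=v_j\ \forall j\}$, assumed non-degenerate (no nonempty proper $I\subsetneq\{1,\dots,N_1\}$, $J\subsetneq\{1,\dots,N_2\}$ with $\sum_{I}u_i=\sum_J v_j$). In $K_{N_1,N_2}$ with supply nodes $\sigma^i$ and demand nodes $\delta^j$, the support graph of $y$ is the set of edges $\{\sigma^i,\delta^j\}$ with $y_{ij}>0$; vertices of $TP(u,v)$ are identified with their support graphs, which are spanning trees. Fix a vertex-tree $F$ and a demand node $\delta^*$; label each edge of $F$ by $+$ or $-$ so that along every path in $F$ starting at $\delta^*$ the labels alternate $+,-,+,\dots$ beginning with $+$. A partially shaded tree is a vertex-tree $C$ with a set of shaded edges contained in $C\cap F$ (shaded edges carry their labels from $F$). A demand node is well-connected in $C$ if it is incident in $C$ to no unshaded edge. For a supply node $\sigma$, each edge of the tree $C$ lies on a path in $C$ starting at $\sigma$; numbering the edges along such paths $1,2,3,\dots$ from $\sigma$, an edge is odd with respect to $\sigma$ if its number is odd. The supply node $\sigma$ satisfies (SIN)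 in $C$ if every edge of $C$ that is odd with respect to $\sigma$ is either unshaded or a shaded $-$edge whose demand node is well-connected in $C$. -}

module Defs where

open import Level using (0ℓ)
open import Data.Nat using (ℕ; zero; suc) renaming (_+_ to _+ℕ_; _*_ to _*ℕ_)
open import Data.Fin using (Fin; zero; suc)
open import Data.Bool using (Bool; true; false; if_then_else_)
open import Data.Sum using (_⊎_; inj₁; inj₂)
open import Data.Product using (Σ; ∃; ∃-syntax; _×_; _,_)
open import Data.Empty using (⊥)
open import Data.List using (List; []; _∷_)
open import Data.List.Relation.Unary.Unique.Propositional using (Unique)
open import Relation.Nullary using (¬_)
open import Relation.Binary.PropositionalEquality using (_≡_; _≢_)
open import Algebra.Structures using (IsCommutativeRing)
open import Relation.Binary.Structures using (IsStrictTotalOrder)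

-- The real numbers, axiomatised as a complete ordered field
-- (any model is isomorphic to ℝ; stdlib has no reals).

record RealField : Set₁ where
  infixl 6 _+_
  infixl 7 _*_
  infix 4 _<_ _≤_
  field
    Carrier : Set
    _+_ _*_ : Carrier → Carrier → Carrier
    -_      : Carrier → Carrier
    0# 1#   : Carrier
    _<_     : Carrier → Carrier → Set
    isCommutativeRing : IsCommutativeRing _≡_ _+_ _*_ -_ 0# 1#
    0≢1     : 0# ≢ 1#
    inverse : ∀ x → x ≢ 0# → ∃[ y ] (x * y ≡ 1#)
    isStrictTotalOrder : IsStrictTotalOrder _≡_ _<_
    +-mono-< : ∀ {x y} z → x < y → x + z < y + z
    *-pos    : ∀ {x y} → 0# < x → 0# < y → 0# < x * y

  _≤_ : Carrier → Carrier → Set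
  x ≤ y = x < y ⊎ x ≡ y

  IsUpperBound : (Carrier → Set) → Carrier → Set
  IsUpperBound P b = ∀ x → P x → x ≤ b

  field
    complete : (P : Carrier → Set) → ∃[ x ] P x → ∃[ b ] IsUpperBound P b →
               ∃[ s ] (IsUpperBound P s × (∀ b → IsUpperBound P b → s ≤ b))

-- Graph-theoretic notions on K_{N1,N2}
-- vertices: inj₁ i = supply node σ^i, inj₂ j = demand node δ^j
-- a subgraph is a predicate on edges {σ^i, δ^j}, i.e. on pairs (i , j)

Node : ℕ → ℕ → Set
Node N₁ N₂ = Fin N₁ ⊎ Fin N₂

EdgeSet : ℕ → ℕ → Set₁
EdgeSet N₁ N₂ = Fin N₁ → Fin N₂ → Set

module _ {N₁ N₂ : ℕ} where

  Adj : EdgeSet N₁ N₂ → Node N₁ N₂ → Node N₁ N₂ → Set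
  Adj G (inj₁ i) (inj₂ j) = G i j
  Adj G (inj₂ j) (inj₁ i) = G i j
  Adj G (inj₁ _) (inj₁ _) = ⊥
  Adj G (inj₂ _) (inj₂ _) = ⊥

  data Chain (G : EdgeSet N₁ N₂) : List (Node N₁ N₂) → Set where
    []  : Chain G []
    [_] : ∀ x → Chain G (x ∷ [])
    _∷_ : ∀ {x y xs} → Adj G x y → Chain G (y ∷ xs) → Chain G (x ∷ y ∷ xs)

  Last : List (Node N₁ N₂) → Node N₁ N₂ → Set
  Last []           z = ⊥
  Last (x ∷ [])     z = x ≡ z
  Last (x ∷ y ∷ xs) z = Last (y ∷ xs) z

  PathFrom : EdgeSet N₁ N₂ → Node N₁ N₂ → List (Node N₁ N₂) → Set
  PathFrom G x xs = ∃[ rest ] (xs ≡ x ∷ rest) × Chain G xs × Unique xs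

  PathBetween : EdgeSet N₁ N₂ → Node N₁ N₂ → Node N₁ N₂ → List (Node N₁ N₂) → Set
  PathBetween G x z xs = PathFrom G x xs × Last xs z

  IsSpanningTree : EdgeSet N₁ N₂ → Set
  IsSpanningTree G =
    (∀ x z → ∃[ xs ] PathBetween G x z xs) ×
    (∀ x z xs ys → PathBetween G x z xs → PathBetween G x z ys → xs ≡ ys)

  Joins : Node N₁ N₂ → Node N₁ N₂ → Fin N₁ → Fin N₂ → Set
  Joins x y i j = (x ≡ inj₁ i × y ≡ inj₂ j) ⊎ (x ≡ inj₂ j × y ≡ inj₁ i)

  -- the k-th edge (numbered 1,2,3,... from the start) of the vertex sequence
  -- xs is {σ^i, δ^j}
  EdgeAt : List (Node N₁ N₂) → ℕ → Fin N₁ → Fin N₂ → Set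
  EdgeAt (x ∷ y ∷ xs) (suc zero)    i j = Joins x y i j
  EdgeAt (x ∷ xs)     (suc (suc k)) i j = EdgeAt xs (suc k) i j
  EdgeAt _            _             i j = ⊥

  IsOdd : ℕ → Set
  IsOdd k = ∃[ m ] (k ≡ suc (2 *ℕ m))

  IsEven : ℕ → Set
  IsEven k = ∃[ m ] (k ≡ 2 *ℕ m)

  OddWrt : EdgeSet N₁ N₂ → Node N₁ N₂ → Fin N₁ → Fin N₂ → Set
  OddWrt G x i j = ∃[ xs ] ∃[ k ] (PathFrom G x xs × EdgeAt xs k i j × IsOdd k)

  EvenWrt : EdgeSet N₁ N₂ → Node N₁ N₂ → Fin N₁ → Fin N₂ → Set
  EvenWrt G x i j = ∃[ xs ] ∃[ k ] (PathFrom G x xs × EdgeAt xs k i j × IsEven k)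

  -- labels of the edges of F w.r.t. the root demand node δ*:
  -- along paths from δ* the labels alternate +,-,+,... starting with +
  PlusEdge : EdgeSet N₁ N₂ → Fin N₂ → Fin N₁ → Fin N₂ → Set
  PlusEdge F δ* i j = F i j × OddWrt F (inj₂ δ*) i j

  MinusEdge : EdgeSet N₁ N₂ → Fin N₂ → Fin N₁ → Fin N₂ → Set
  MinusEdge F δ* i j = F i j × EvenWrt F (inj₂ δ*) i j

  IsShading : EdgeSet N₁ N₂ → EdgeSet N₁ N₂ → EdgeSet N₁ N₂ → Set
  IsShading F C S = ∀ i j → S i j → C i j × F i j

  WellConnected : EdgeSet N₁ N₂ → EdgeSet N₁ N₂ → Fin N₂ → Set
  WellConnected C S j = ∀ i → C i j → S i j

  SIN : EdgeSet N₁ N₂ → Fin N₂ → EdgeSet N₁ N₂ → EdgeSet N₁ N₂ → Fin N₁ → Set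
  SIN F δ* C S s =
    ∀ i j → C i j → OddWrt C (inj₁ s) i j →
      ¬ S i j ⊎ (S i j × MinusEdge F δ* i j × WellConnected C S j)

  OnlyShadedPlus : EdgeSet N₁ N₂ → Fin N₂ → EdgeSet N₁ N₂ → EdgeSet N₁ N₂ → Fin N₂ → Set
  OnlyShadedPlus F δ* C S j = ∀ i → C i j → S i j × PlusEdge F δ* i j

module _ (R : RealField) where
  open RealField R

  sumF : ∀ {n} → (Fin n → Carrier) → Carrier
  sumF {zero}  f = 0#
  sumF {suc n} f = f zero + sumF (λ k → f (suc k))

  sumOver : ∀ {n} → (Fin n → Bool) → (Fin n → Carrier) → Carrier
  sumOver I f = sumF (λ k → if I k then f k else 0#)

  NonemptyProper : ∀ {n} → (Fin n → Bool) → Set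
  NonemptyProper I = ∃[ k ] (I k ≡ true) × ∃[ k ] (I k ≡ false)

  Matrix : ℕ → ℕ → Set
  Matrix N₁ N₂ = Fin N₁ → Fin N₂ → Carrier

  -- admissible margins: positive entries, equal totals, non-degenerate
  Margins : ∀ {N₁ N₂} → (Fin N₁ → Carrier) → (Fin N₂ → Carrier) → Set
  Margins u v =
    (∀ i → 0# < u i) × (∀ j → 0# < v j) × (sumF u ≡ sumF v) ×
    (∀ I J → NonemptyProper I → NonemptyProper J → ¬ (sumOver I u ≡ sumOver J v))

  InTP : ∀ {N₁ N₂} → (Fin N₁ → Carrier) → (Fin N₂ → Carrier) → Matrix N₁ N₂ → Set
  InTP u v y =
    (∀ i j → 0# ≤ y i j) ×
    (∀ i → sumF (λ j → y i j) ≡ u i) ×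
    (∀ j → sumF (λ i → y i j) ≡ v j)

  IsVertex : ∀ {N₁ N₂} → (Fin N₁ → Carrier) → (Fin N₂ → Carrier) → Matrix N₁ N₂ → Set
  IsVertex u v y =
    InTP u v y ×
    (∀ y₁ y₂ t → InTP u v y₁ → InTP u v y₂ → 0# < t → t < 1# →
      (∀ i j → y i j ≡ t * y₁ i j + (1# + - t) * y₂ i j) →
      ∀ i j → y₁ i j ≡ y₂ i j)

  SupportGraph : ∀ {N₁ N₂} → Matrix N₁ N₂ → EdgeSet N₁ N₂ → Set
  SupportGraph y G = ∀ i j → (G i j → 0# < y i j) × (0# < y i j → G i j)

  -- G is a vertex-tree: the support graph of a vertex of TP(u,v)
  -- (such a support graph is a spanning tree, as recorded in the paper)
  VertexTree : ∀ {N₁ N₂} → (Fin N₁ → Carrier) → (Fin N₂ → Carrier) → EdgeSet N₁ N₂ → Set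
  VertexTree u v G = (∃[ y ] (IsVertex u v y × SupportGraph y G)) × IsSpanningTree G

module Submission where

-- Idea of the proof.  Only the tree structure of F and C matters.
--
-- (1) In a graph with unique paths, an edge can not be both odd and even
--     with respect to the same root: two paths from the root through the
--     edge agree up to it, so they either number it identically (and a
--     number is not both odd and even) or cross it in opposite directions
--     (and then one of them would revisit a vertex).
-- (2) In a connected bipartite graph, every demand node δ^j has an incident
--     edge that is odd with respect to any supply node σ: the last edge of
--     the path from σ to δ^j, since the path alternates sides.
--
-- For lemma3 take the edge given by (2) for the (SIN) node of C at δ^j.
-- (SIN) makes it unshaded or a shaded −edge; an "only shaded +" node rules
-- out the first, and (1) for the tree F rules out the second.  If δ^j is
-- well-connected the edge is shaded, so (SIN) makes it a shaded −edge.

open import Defs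
open import Data.Nat using (ℕ; zero; suc; _*_)
open import Data.Nat.Properties using (even≢odd; *-suc)
open import Data.Fin using (Fin)
open import Data.Product using (∃-syntax; _×_; _,_; proj₁; proj₂)
open import Data.Sum using (inj₁; inj₂)
open import Data.Empty using (⊥; ⊥-elim)
open import Data.List using (List; []; _∷_; _++_; _∷ʳ_; length)
open import Data.List.Properties using (++-assoc; ∷ʳ-injectiveˡ)
open import Data.List.Relation.Unary.All using (_∷_)
open import Data.List.Relation.Unary.All.Properties as All using ()
open import Data.List.Relation.Unary.AllPairs using ([]; _∷_)
open import Data.List.Relation.Unary.Unique.Propositional using (Unique)
open import Relation.Nullary using (¬_)
open import Relation.Binary.PropositionalEquality
  using (_≡_; refl; sym; trans; cong; subst)

odd∧even⇒⊥ : ∀ {N₁ N₂} {k : ℕ} → IsOdd {N₁} {N₂} k → IsEven {N₁} {N₂} k → ⊥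
odd∧even⇒⊥ (m , k≡odd) (n , k≡even) = even≢odd n m (trans (sym k≡even) k≡odd)

unique-++⁻ˡ : ∀ {A : Set} (xs : List A) {ys : List A} → Unique (xs ++ ys) → Unique xs
unique-++⁻ˡ []       _             = []
unique-++⁻ˡ (x ∷ xs) (x∉rest ∷ u) = All.++⁻ˡ xs x∉rest ∷ unique-++⁻ˡ xs u

unique-++⁻ʳ : ∀ {A : Set} (xs : List A) {ys : List A} → Unique (xs ++ ys) → Unique ys
unique-++⁻ʳ []       u       = u
unique-++⁻ʳ (x ∷ xs) (_ ∷ u) = unique-++⁻ʳ xs u

module _ {N₁ N₂ : ℕ} where

  UniquePaths : EdgeSet N₁ N₂ → Set
  UniquePaths G = ∀ x z xs ys → PathBetween G x z xs → PathBetween G x z ys → xs ≡ ys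

  Connected : EdgeSet N₁ N₂ → Set
  Connected G = ∀ x z → ∃[ xs ] PathBetween G x z xs

  chain-++⁻ˡ : ∀ {G} (xs : List (Node N₁ N₂)) {ys} → Chain G (xs ++ ys) → Chain G xs
  chain-++⁻ˡ []           _       = []
  chain-++⁻ˡ (x ∷ [])     _       = [ x ]
  chain-++⁻ˡ (x ∷ y ∷ xs) (a ∷ c) = a ∷ chain-++⁻ˡ (y ∷ xs) c

  last-∷ʳ : ∀ (xs : List (Node N₁ N₂)) x → Last (xs ∷ʳ x) x
  last-∷ʳ []           x = refl
  last-∷ʳ (_ ∷ [])     x = refl
  last-∷ʳ (_ ∷ y ∷ xs) x = last-∷ʳ (y ∷ xs) x

  pathFrom-prefix : ∀ {G d} pre x post →
                    PathFrom G d (pre ++ x ∷ post) → PathBetween G d x (pre ∷ʳ x)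
  pathFrom-prefix {G} {d} pre x post (rest , starts , c , u) =
    ( proj₁ cut-start , proj₂ cut-start
    , chain-++⁻ˡ (pre ∷ʳ x) (subst (Chain G) reassoc c)
    , unique-++⁻ˡ (pre ∷ʳ x) (subst Unique reassoc u) )
    , last-∷ʳ pre x
    where
    reassoc : pre ++ x ∷ post ≡ (pre ∷ʳ x) ++ post
    reassoc = sym (++-assoc pre (x ∷ []) post)
    -- The prefix still starts at d (when pre = [], the cut vertex x is d).
    starts-prefix : ∀ pre → pre ++ x ∷ post ≡ d ∷ rest → ∃[ r ] (pre ∷ʳ x ≡ d ∷ r)
    starts-prefix []      refl = [] , refl
    starts-prefix (_ ∷ p) refl = p ∷ʳ x , refl
    cut-start : ∃[ r ] (pre ∷ʳ x ≡ d ∷ r)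
    cut-start = starts-prefix pre starts

  prefix-unique : ∀ {G d} → UniquePaths G → ∀ pre₁ pre₂ x post₁ post₂ →
                  PathFrom G d (pre₁ ++ x ∷ post₁) → PathFrom G d (pre₂ ++ x ∷ post₂) →
                  pre₁ ≡ pre₂
  prefix-unique {d = d} unique pre₁ pre₂ x post₁ post₂ p q =
    ∷ʳ-injectiveˡ pre₁ pre₂
      (unique d x _ _ (pathFrom-prefix pre₁ x post₁ p) (pathFrom-prefix pre₂ x post₂ q))

  -- With unique paths, no two paths from the same root cross an edge in
  -- opposite directions: the second would have to visit a, b, a.
  no-reversed-edge : ∀ {G d} → UniquePaths G → ∀ pre₁ pre₂ a b post₁ post₂ →
                     PathFrom G d (pre₁ ++ a ∷ b ∷ post₁) →
                     PathFrom G d (pre₂ ++ b ∷ a ∷ post₂) → ⊥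
  no-reversed-edge {G} {d} unique pre₁ pre₂ a b post₁ post₂ p q =
    revisits (unique-++⁻ʳ pre₁ (subst Unique (++-assoc pre₁ (a ∷ []) _) q-via-a))
    where
    p-via-b : PathFrom G d ((pre₁ ∷ʳ a) ++ b ∷ post₁)
    p-via-b = subst (PathFrom G d) (sym (++-assoc pre₁ (a ∷ []) (b ∷ post₁))) p
    pre₂≡ : pre₂ ≡ pre₁ ∷ʳ a
    pre₂≡ = prefix-unique unique pre₂ (pre₁ ∷ʳ a) b (a ∷ post₂) post₁ q p-via-b
    q-via-a : Unique ((pre₁ ∷ʳ a) ++ b ∷ a ∷ post₂)
    q-via-a = subst (λ pre → Unique (pre ++ b ∷ a ∷ post₂)) pre₂≡ (proj₂ (proj₂ (proj₂ q)))
    revisits : Unique (a ∷ b ∷ a ∷ post₂) → ⊥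
    revisits ((_ ∷ a≢a ∷ _) ∷ _) = a≢a refl

  edgeAt-split : ∀ (xs : List (Node N₁ N₂)) k {i j} → EdgeAt xs k i j →
                 ∃[ pre ] ∃[ a ] ∃[ b ] ∃[ post ]
                   (xs ≡ pre ++ a ∷ b ∷ post × Joins a b i j × k ≡ suc (length pre))
  edgeAt-split (x ∷ y ∷ xs) (suc zero)    e = [] , x , y , xs , refl , e , refl
  edgeAt-split (x ∷ y ∷ xs) (suc (suc k)) e
    with edgeAt-split (y ∷ xs) (suc k) e
  ... | pre , a , b , post , split , joins , refl =
    x ∷ pre , a , b , post , cong (x ∷_) split , joins , refl
  edgeAt-split []           zero          ()
  edgeAt-split []           (suc zero)    ()
  edgeAt-split []           (suc (suc _)) ()
  edgeAt-split (_ ∷ [])     zero          ()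
  edgeAt-split (_ ∷ [])     (suc zero)    ()
  edgeAt-split (_ ∷ [])     (suc (suc _)) ()
  edgeAt-split (_ ∷ _ ∷ _)  zero          ()

  odd∧even-wrt⇒⊥ : ∀ {G} → UniquePaths G → ∀ d {i j} →
                   OddWrt G d i j → EvenWrt G d i j → ⊥
  odd∧even-wrt⇒⊥ unique d (xs , k , p , e , odd) (ys , l , q , f , even)
    with edgeAt-split xs k e | edgeAt-split ys l f
  ... | pre₁ , a₁ , b₁ , post₁ , refl , joins₁ , refl
      | pre₂ , a₂ , b₂ , post₂ , refl , joins₂ , refl = by-direction joins₁ joins₂
    where
    -- Same direction: equal prefixes, hence equal edge numbers.
    same-start : a₁ ≡ a₂ → ⊥
    same-start refl = odd∧even⇒⊥ {N₁} {N₂} odd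
      (subst (IsEven {N₁} {N₂}) (cong (λ pre → suc (length pre))
        (sym (prefix-unique unique pre₁ pre₂ a₁ (b₁ ∷ post₁) (b₂ ∷ post₂) p q))) even)
    by-direction : ∀ {i j} → Joins a₁ b₁ i j → Joins a₂ b₂ i j → ⊥
    by-direction (inj₁ (refl , _))    (inj₁ (refl , _))    = same-start refl
    by-direction (inj₂ (refl , _))    (inj₂ (refl , _))    = same-start refl
    by-direction (inj₁ (refl , refl)) (inj₂ (refl , refl)) =
      no-reversed-edge unique pre₁ pre₂ a₁ b₁ post₁ post₂ p q
    by-direction (inj₂ (refl , refl)) (inj₁ (refl , refl)) =
      no-reversed-edge unique pre₂ pre₁ a₂ b₂ post₂ post₁ q p

  -- A walk from σ^s ending at δ^j has its last edge, an edge of G at δ^j,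
  -- at an odd position: positions alternate supply → demand, demand → supply.
  last-edge-odd : ∀ {G} s j (rest : List (Node N₁ N₂)) →
                  Chain G (inj₁ s ∷ rest) → Last (inj₁ s ∷ rest) (inj₂ j) →
                  ∃[ i ] ∃[ m ] (G i j × EdgeAt (inj₁ s ∷ rest) (suc (2 * m)) i j)
  last-edge-odd s j (inj₂ _ ∷ [])            (s-j ∷ _)             refl =
    s , 0 , s-j , inj₁ (refl , refl)
  last-edge-odd s j (inj₂ j′ ∷ inj₁ s′ ∷ rest) (_ ∷ _ ∷ c) ends
    with last-edge-odd s′ j rest c ends
  ... | i , m , i-j , e =
    i , suc m , i-j , subst (λ k → EdgeAt (inj₁ s ∷ inj₂ j′ ∷ inj₁ s′ ∷ rest) k i j)
                            (cong suc (sym (*-suc 2 m))) e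
  last-edge-odd s j (inj₁ _ ∷ _)               (() ∷ _)            _
  last-edge-odd s j (inj₂ _ ∷ inj₂ _ ∷ _)      (_ ∷ () ∷ _)        _

  odd-edge-at : ∀ {G} → Connected G → ∀ s j → ∃[ i ] (G i j × OddWrt G (inj₁ s) i j)
  odd-edge-at connected s j with connected (inj₁ s) (inj₂ j)
  ... | _ , path@(rest , refl , c , _) , ends with last-edge-odd s j rest c ends
  ... | i , m , i-j , e = i , i-j , (inj₁ s ∷ rest) , suc (2 * m) , path , e , (m , refl)

lemma3 : (R : RealField) → (N₁ N₂ : ℕ) →
    (u : Fin N₁ → RealField.Carrier R) → (v : Fin N₂ → RealField.Carrier R) →
    Margins R u v →
    (F : EdgeSet N₁ N₂) → VertexTree R u v F → (δ* : Fin N₂) →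
    (C : EdgeSet N₁ N₂) → VertexTree R u v C →
    (S : EdgeSet N₁ N₂) → IsShading F C S →
    ∃[ σ ] SIN F δ* C S σ →
    (¬ (∃[ j ] OnlyShadedPlus F δ* C S j)) ×
    (∀ j → WellConnected C S j → ∃[ i ] (C i j × S i j × MinusEdge F δ* i j))
lemma3 R N₁ N₂ u v _ F (_ , _ , F-unique) δ* C (_ , C-connected , _) S _ (σ , sin) =
  no-only-shaded-plus , well-connected⇒minus
  where
  no-only-shaded-plus : ¬ (∃[ j ] OnlyShadedPlus F δ* C S j)
  no-only-shaded-plus (j , only-plus) with odd-edge-at C-connected σ j
  ... | i , i-j , odd with sin i j i-j odd | only-plus i i-j
  ... | inj₁ unshaded               | shaded , _        = unshaded shaded
  ... | inj₂ (_ , (_ , minus) , _)  | _ , (_ , plus)    =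
    odd∧even-wrt⇒⊥ F-unique (inj₂ δ*) plus minus
  well-connected⇒minus : ∀ j → WellConnected C S j → ∃[ i ] (C i j × S i j × MinusEdge F δ* i j)
  well-connected⇒minus j well-connected with odd-edge-at C-connected σ j
  ... | i , i-j , odd with sin i j i-j odd
  ... | inj₁ unshaded              = ⊥-elim (unshaded (well-connected i i-j))
  ... | inj₂ (shaded , minus , _)  = i , i-j , shaded , minus
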